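{- Let $\sigma,\tau\in\mathbb{P}$ with $\sigma\subseteq\tau$. Then every finite sequence that is $\mathsf{Good}_1(\sigma)$ is $\mathsf{Good}_1(\tau)$, and every finite sequence of pairs that is $\mathsf{Good}_2(\sigma)$ is $\mathsf{Good}_2(\tau)$.
   Context: For each $k\in\mathbb{Z}$ let $\mathsf{c}_k$ be a distinct constant symbol, and $V^{\star}=\{\mathsf{c}_k:k\in\mathbb{Z}\}$. Let $\omega$ be the set of nonnegative integers and $\mathcal{X}$ the set of all $X\subseteq V^{\star}$ whose symmetric difference with $\{\mathsf{c}_k:k\in\omega\}$ is finite. Let $\mathbb{P}$ be the set of all partial one-to-one maps $\sigma$ from $V^{\star}$ to $\mathcal{X}$ (domain $\mathrm{dom}(\sigma)\subseteq V^{\star}$) such that (a) $u\in\sigma(u)$ for all $u\in\mathrm{dom}(\sigma)$, and (b) both $\bigcap\sigma[\mathrm{dom}(\sigma)]\setminus\mathrm{dom}(\sigma)$ and $V^{\star}\setminus\bigcup\sigma[\mathrm{dom}(\sigma)]$ are infinite. Write $\sigma\subseteq\tau$ iff $\sigma$ is a restriction of $\tau$. For $\sigma\in\mathbb{P}$ and $x_0,\dots,x_n\in V^{\star}$, $\Delta(\sigma;x_0,\dots,x_n)$ is the smallest $W\subseteq V^{\star}$ such that: (1) $\{x_0,\dots,x_n\}\subseteq W$; (2) $\sigma(u)\setminus\sigma(v)\subseteq W$ for all $u,v\in W\cap\mathrm{dom}(\sigma)$; (3) if $v\in\mathrm{dom}(\sigma)$ and $\sigma(v)=(\sigma(u)\setminus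 A)\cup B$ for some $u\in W$ and finite $A,B\subseteq W$, then $v\in W$. The sequence $x_0,\dots,x_n$ is $\mathsf{Good}_1(\sigma)$ if (i) $\sigma$ is defined on all of $\Delta(\sigma;\vec{x})$, and (ii) for every $u\in\Delta(\sigma;\vec{x})$ and all finite $A,B\subseteq\Delta(\sigma;\vec{x})$ there is $v\in\Delta(\sigma;\vec{x})$ with $\sigma(v)=(\sigma(u)\setminus A)\cup B$. The relation $\in^{\sigma}$ on $V^{\star}$ is defined by $\mathsf{c}_i\in^{\sigma}\mathsf{c}_j$ iff $\mathsf{c}_j\in\mathrm{dom}(\sigma)$ and $\mathsf{c}_i\in\sigma(\mathsf{c}_j)$. A (possibly empty) sequence $(x_0,y_0),\dots,(x_m,y_m)$ of pairs of elements of $V^{\star}$ is $\mathsf{Good}_2(\sigma)$ if both $x_0,\dots,x_m$ and $y_0,\dots,y_m$ are $\mathsf{Good}_1(\sigma)$ and there is an isomorphism $f:(\Delta(\sigma;\vec{x}),\in^{\sigma})\to(\Delta(\sigma;\vec{y}),\in^{\sigma})$ (with $\in^{\sigma}$ restricted to these sets) such that $f(x_i)=y_i$ for all $i\le m$. -}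

module Defs where

open import Data.Integer using (ℤ; _≤_; +_)
open import Data.List using (List; map)
open import Data.List.Membership.Propositional using (_∈_; _∉_)
open import Data.List.Relation.Unary.All using (All)
open import Data.Product using (Σ; ∃; _×_; _,_; proj₁; proj₂)
open import Data.Sum using (_⊎_)
open import Relation.Nullary using (¬_)
open import Relation.Binary.PropositionalEquality using (_≡_)

-- The constant c_k is represented by the integer k, so V* = ℤ.
-- Subsets of V* are predicates ℤ → Set.

Subset : Set₁
Subset = ℤ → Set

_⟺_ : Set → Set → Set
A ⟺ B = (A → B) × (B → A)

_≐_ : Subset → Subset → Set
X ≐ Y = ∀ k → X k ⟺ Y k

Finite : Subset → Set
Finite S = ∃ λ (L : List ℤ) → ∀ k → S k → k ∈ L

Infinite : Subset → Set
Infinite S = ¬ Finite S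

ω : Subset
ω k = + 0 ≤ k

-- X ∈ 𝒳 : symmetric difference with ω is finite
-- (all elements outside a finite list L behave as in ω)
In𝒳 : Subset → Set
In𝒳 X = ∃ λ (L : List ℤ) → ∀ k → k ∉ L → X k ⟺ ω k

_∖_∪_ : Subset → List ℤ → List ℤ → Subset
(X ∖ A ∪ B) k = (X k × k ∉ A) ⊎ k ∈ B

-- A partial map σ from V* to subsets of V*:
-- dom is its domain, val u is σ(u) (only meaningful for u ∈ dom).
record PMap : Set₁ where
  field
    dom : Subset
    val : ℤ → Subset
open PMap public

record Inℙ (σ : PMap) : Set where
  field
    into𝒳     : ∀ u → dom σ u → In𝒳 (val σ u)
    injective : ∀ u v → dom σ u → dom σ v → val σ u ≐ val σ v → u ≡ v
    self∈     : ∀ u → dom σ u → val σ u u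
    infinite₁ : Infinite (λ k → (∀ u → dom σ u → val σ u k) × ¬ dom σ k)
    infinite₂ : Infinite (λ k → ¬ (∃ λ u → dom σ u × val σ u k))

_⊑_ : PMap → PMap → Set
σ ⊑ τ = ∀ u → dom σ u → dom τ u × (val σ u ≐ val τ u)

-- Δ(σ; xs): least W satisfying (1)–(3), as an inductive predicate
data Δ (σ : PMap) (xs : List ℤ) : Subset where
  base : ∀ {x} → x ∈ xs → Δ σ xs x
  diff : ∀ {u v w} → Δ σ xs u → dom σ u → Δ σ xs v → dom σ v →
         val σ u w → ¬ val σ v w → Δ σ xs w
  clos : ∀ {u v} (A B : List ℤ) → dom σ v → Δ σ xs u → dom σ u →
         All (Δ σ xs) A → All (Δ σ xs) B →
         val σ v ≐ (val σ u ∖ A ∪ B) → Δ σ xs v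

Good₁ : PMap → List ℤ → Set
Good₁ σ xs =
  (∀ u → Δ σ xs u → dom σ u) ×
  (∀ u (A B : List ℤ) → Δ σ xs u → All (Δ σ xs) A → All (Δ σ xs) B →
     ∃ λ v → Δ σ xs v × dom σ v × (val σ v ≐ (val σ u ∖ A ∪ B)))

_∈[_]_ : ℤ → PMap → ℤ → Set
i ∈[ σ ] j = dom σ j × val σ j i

-- isomorphism (Δ(σ;xs), ∈^σ) → (Δ(σ;ys), ∈^σ) sending the pairs ps (x_i ↦ y_i)
record Iso (σ : PMap) (ps : List (ℤ × ℤ)) : Set where
  xs = map proj₁ ps
  ys = map proj₂ ps
  field
    f       : (u : ℤ) → Δ σ xs u → ℤ
    g       : (u : ℤ) → Δ σ ys u → ℤ
    f-into  : ∀ u p → Δ σ ys (f u p)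
    g-into  : ∀ u p → Δ σ xs (g u p)
    f-irr   : ∀ u p q → f u p ≡ f u q
    g-irr   : ∀ u p q → g u p ≡ g u q
    gf      : ∀ u p → g (f u p) (f-into u p) ≡ u
    fg      : ∀ u p → f (g u p) (g-into u p) ≡ u
    pres    : ∀ a b (p : Δ σ xs a) (q : Δ σ xs b) →
              (a ∈[ σ ] b) ⟺ (f a p ∈[ σ ] f b q)
    sends   : ∀ {x y} → (x , y) ∈ ps → ∀ p → f x p ≡ y

Good₂ : PMap → List (ℤ × ℤ) → Set
Good₂ σ ps = Good₁ σ (map proj₁ ps) × Good₁ σ (map proj₂ ps) × Iso σ ps

-- Passing from σ to τ ⊒ σ only adds new points to the domain; it never changes a value.
-- Hence every clause generating Δ(σ; xs) is also a clause for τ, so Δ(σ; xs) ⊆ Δ(τ; xs).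
-- Conversely, if xs is Good₁(σ), every value (σ(u) ∖ A) ∪ B required by clause (3) of
-- Δ(τ; xs) is already realised inside Δ(σ; xs), and injectivity of τ identifies the new
-- point with that witness; so the two closures coincide. On a common closure on which σ is
-- total, σ and τ induce the same relation ∈, so Good₁ and isomorphisms transfer.
module Submission where

open import Defs
open import Data.Integer using (ℤ)
open import Data.List using (List)
open import Data.List.Relation.Unary.All using (All; []; _∷_)
open import Data.Product using (∃; _×_; _,_; proj₁; proj₂)
open import Data.Sum using (inj₁; inj₂)
open import Relation.Binary.PropositionalEquality using (trans; subst)
open import Relation.Unary using (_⊆_)

≐-sym : ∀ {X Y} → X ≐ Y → Y ≐ X
≐-sym X≐Y k = proj₂ (X≐Y k) , proj₁ (X≐Y k)

≐-trans : ∀ {X Y Z} → X ≐ Y → Y ≐ Z → X ≐ Z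
≐-trans X≐Y Y≐Z k =
  (λ x → proj₁ (Y≐Z k) (proj₁ (X≐Y k) x)) , (λ z → proj₂ (X≐Y k) (proj₂ (Y≐Z k) z))

∖∪-cong : ∀ {X Y} (A B : List ℤ) → X ≐ Y → (X ∖ A ∪ B) ≐ (Y ∖ A ∪ B)
∖∪-cong {X} {Y} A B X≐Y k = to , from
  where
  to : (X ∖ A ∪ B) k → (Y ∖ A ∪ B) k
  to (inj₁ (x , k∉A)) = inj₁ (proj₁ (X≐Y k) x , k∉A)
  to (inj₂ k∈B)       = inj₂ k∈B
  from : (Y ∖ A ∪ B) k → (X ∖ A ∪ B) k
  from (inj₁ (y , k∉A)) = inj₁ (proj₂ (X≐Y k) y , k∉A)
  from (inj₂ k∈B)       = inj₂ k∈B

module Restriction {σ τ : PMap} (σ⊑τ : σ ⊑ τ) where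

  ⊑-dom : ∀ {u} → dom σ u → dom τ u
  ⊑-dom {u} u∈σ = proj₁ (σ⊑τ u u∈σ)

  ⊑-val : ∀ {u} → dom σ u → val σ u ≐ val τ u
  ⊑-val {u} u∈σ = proj₂ (σ⊑τ u u∈σ)

  ⊑-∖∪ : ∀ {u v} (A B : List ℤ) → dom σ u → dom σ v →
         val σ v ≐ (val σ u ∖ A ∪ B) → val τ v ≐ (val τ u ∖ A ∪ B)
  ⊑-∖∪ A B u∈σ v∈σ e =
    ≐-trans (≐-sym (⊑-val v∈σ)) (≐-trans e (∖∪-cong A B (⊑-val u∈σ)))

  ⊑-∈ : ∀ {a b} → dom σ b → (a ∈[ σ ] b) ⟺ (a ∈[ τ ] b)
  ⊑-∈ {a} b∈σ =
    (λ (_ , a∈σb) → ⊑-dom b∈σ , proj₁ (⊑-val b∈σ a) a∈σb) ,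
    (λ (_ , a∈τb) → b∈σ , proj₂ (⊑-val b∈σ a) a∈τb)

  Δ-mono : ∀ {xs} → Δ σ xs ⊆ Δ τ xs
  All-Δ-mono : ∀ {xs} → All (Δ σ xs) ⊆ All (Δ τ xs)
  Δ-mono (base x∈xs) = base x∈xs
  Δ-mono (diff u∈Δ u∈σ v∈Δ v∈σ w∈σu w∉σv) =
    diff (Δ-mono u∈Δ) (⊑-dom u∈σ) (Δ-mono v∈Δ) (⊑-dom v∈σ)
      (proj₁ (⊑-val u∈σ _) w∈σu) (λ w∈τv → w∉σv (proj₂ (⊑-val v∈σ _) w∈τv))
  Δ-mono (clos A B v∈σ u∈Δ u∈σ A⊆Δ B⊆Δ e) =
    clos A B (⊑-dom v∈σ) (Δ-mono u∈Δ) (⊑-dom u∈σ) (All-Δ-mono A⊆Δ) (All-Δ-mono B⊆Δ)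
      (⊑-∖∪ A B u∈σ v∈σ e)
  All-Δ-mono []       = []
  All-Δ-mono (p ∷ ps) = Δ-mono p ∷ All-Δ-mono ps

  module _ (τ-ℙ : Inℙ τ) {xs : List ℤ} (good : Good₁ σ xs) where

    private
      total : Δ σ xs ⊆ dom σ
      total = proj₁ good _

      realised : ∀ u (A B : List ℤ) → Δ σ xs u → All (Δ σ xs) A → All (Δ σ xs) B →
                 ∃ λ v → Δ σ xs v × dom σ v × (val σ v ≐ (val σ u ∖ A ∪ B))
      realised = proj₂ good

    Δ-reflect : Δ τ xs ⊆ Δ σ xs
    All-Δ-reflect : All (Δ τ xs) ⊆ All (Δ σ xs)
    Δ-reflect (base x∈xs) = base x∈xs
    Δ-reflect (diff u∈Δ _ v∈Δ _ w∈τu w∉τv) =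
      let u∈σ = total (Δ-reflect u∈Δ) ; v∈σ = total (Δ-reflect v∈Δ) in
      diff (Δ-reflect u∈Δ) u∈σ (Δ-reflect v∈Δ) v∈σ
        (proj₂ (⊑-val u∈σ _) w∈τu) (λ w∈σv → w∉τv (proj₁ (⊑-val v∈σ _) w∈σv))
    Δ-reflect {v} (clos {u} A B v∈τ u∈Δ _ A⊆Δ B⊆Δ e)
      with realised u A B (Δ-reflect u∈Δ) (All-Δ-reflect A⊆Δ) (All-Δ-reflect B⊆Δ)
    ... | v′ , v′∈Δ , v′∈σ , e′ =
      subst (Δ σ xs)
        (Inℙ.injective τ-ℙ v′ v (⊑-dom v′∈σ) v∈τ
          (≐-trans (⊑-∖∪ A B (total (Δ-reflect u∈Δ)) v′∈σ e′) (≐-sym e)))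
        v′∈Δ
    All-Δ-reflect []       = []
    All-Δ-reflect (p ∷ ps) = Δ-reflect p ∷ All-Δ-reflect ps

    Good₁-mono : Good₁ τ xs
    Good₁-mono = (λ _ u∈Δ → ⊑-dom (total (Δ-reflect u∈Δ))) , realisedτ
      where
      realisedτ : ∀ u (A B : List ℤ) → Δ τ xs u → All (Δ τ xs) A → All (Δ τ xs) B →
                  ∃ λ v → Δ τ xs v × dom τ v × (val τ v ≐ (val τ u ∖ A ∪ B))
      realisedτ u A B u∈Δ A⊆Δ B⊆Δ
        with realised u A B (Δ-reflect u∈Δ) (All-Δ-reflect A⊆Δ) (All-Δ-reflect B⊆Δ)
      ... | v , v∈Δ , v∈σ , e =
        v , Δ-mono v∈Δ , ⊑-dom v∈σ , ⊑-∖∪ A B (total (Δ-reflect u∈Δ)) v∈σ e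

  Good₂-mono : Inℙ τ → ∀ {ps} → Good₂ σ ps → Good₂ τ ps
  Good₂-mono τ-ℙ (good-xs , good-ys , iso) =
    Good₁-mono τ-ℙ good-xs , Good₁-mono τ-ℙ good-ys , record
      { f      = λ u p → f u (down-xs p)
      ; g      = λ u p → g u (down-ys p)
      ; f-into = λ u p → Δ-mono (f-into u (down-xs p))
      ; g-into = λ u p → Δ-mono (g-into u (down-ys p))
      ; f-irr  = λ u _ _ → f-irr u _ _
      ; g-irr  = λ u _ _ → g-irr u _ _
      ; gf     = λ u _ → trans (g-irr _ _ _) (gf u _)
      ; fg     = λ u _ → trans (f-irr _ _ _) (fg u _)
      ; pres   = presτ
      ; sends  = λ x↦y _ → sends x↦y _
      }
    where
    open Iso iso
    down-xs : Δ τ xs ⊆ Δ σ xs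
    down-xs = Δ-reflect τ-ℙ good-xs

    down-ys : Δ τ ys ⊆ Δ σ ys
    down-ys = Δ-reflect τ-ℙ good-ys

    presτ : ∀ a b (p : Δ τ xs a) (q : Δ τ xs b) →
            (a ∈[ τ ] b) ⟺ (f a (down-xs p) ∈[ τ ] f b (down-xs q))
    presτ a b p q =
      (λ a∈b → proj₁ (⊑-∈ fb∈σ) (proj₁ (pres a b _ _) (proj₂ (⊑-∈ b∈σ) a∈b))) ,
      (λ fa∈fb → proj₁ (⊑-∈ b∈σ) (proj₂ (pres a b _ _) (proj₂ (⊑-∈ fb∈σ) fa∈fb)))
      where
      b∈σ : dom σ b
      b∈σ = proj₁ good-xs b (down-xs q)

      fb∈σ : dom σ (f b (down-xs q))
      fb∈σ = proj₁ good-ys _ (f-into b (down-xs q))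

lemma4 : (σ τ : PMap) → Inℙ σ → Inℙ τ → σ ⊑ τ →
         ((xs : List ℤ) → Good₁ σ xs → Good₁ τ xs) ×
         ((ps : List (ℤ × ℤ)) → Good₂ σ ps → Good₂ τ ps)
lemma4 σ τ _ τ-ℙ σ⊑τ = (λ _ → Good₁-mono τ-ℙ) , (λ _ → Good₂-mono τ-ℙ)
  where open Restriction σ⊑τ
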